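{- Let $g\ge 1$ be an integer and let $\mathrm{ng}(g)$ denote the number of reflective numerical semigroups of genus $g$. Then $\mathrm{ng}(g)=g+1-\tau(g)$, where $\tau(g)$ is the number of positive divisors of $g$.
   Context: A numerical semigroup is a submonoid $S$ of $(\mathbb{N}_0,+)$ with finite complement; its genus is $g(S)=\#(\mathbb{N}_0\setminus S)$. A numerical semigroup $S$ of genus $g\ge1$ is called reflective if for every integer $z$ with $0\le z\le g-1$, exactly one of $z$ and $z+g$ lies in $S$. -}

module Defs where

open import Data.Bool using (Bool; true; false; not)
open import Data.Nat using (ℕ; zero; suc; _+_; _∸_; _≤_; _<_)
open import Data.Nat.Divisibility using (_∣_; _∣?_)
open import Data.List using (List; []; _∷_; length; filter; upTo; map)
open import Data.List.Relation.Unary.All using (All)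
open import Data.List.Relation.Unary.Any using (Any)
open import Data.List.Relation.Unary.AllPairs using (AllPairs)
open import Data.Product using (Σ; _×_)
open import Data.Sum using (_⊎_)
open import Relation.Nullary using (¬_)
open import Relation.Binary.PropositionalEquality using (_≡_)

record NumericalSemigroup : Set where
  field
    mem       : ℕ → Bool
    has-zero  : mem 0 ≡ true
    closed    : ∀ a b → mem a ≡ true → mem b ≡ true → mem (a + b) ≡ true
    bound     : ℕ
    cofinite  : ∀ n → bound ≤ n → mem n ≡ true
open NumericalSemigroup public

_∈S_ : ℕ → NumericalSemigroup → Set
n ∈S S = mem S n ≡ true

gaps : NumericalSemigroup → List ℕ
gaps S = filter (λ n → Data.Bool._≟_ (mem S n) false) (upTo (bound S))
  where import Data.Bool

-- genus = number of gaps (independent of the chosen bound)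
genus : NumericalSemigroup → ℕ
genus S = length (gaps S)

_≈S_ : NumericalSemigroup → NumericalSemigroup → Set
S ≈S T = ∀ n → mem S n ≡ mem T n

ReflectiveOfGenus : ℕ → NumericalSemigroup → Set
ReflectiveOfGenus g S =
  genus S ≡ g ×
  (∀ z → z < g →
     (z ∈S S × ¬ ((z + g) ∈S S)) ⊎ (¬ (z ∈S S) × (z + g) ∈S S))

-- "the number of numerical semigroups satisfying P is k":
-- a duplicate-free (up to ≈S) list of length k of semigroups satisfying P
-- such that every semigroup satisfying P is ≈S to one in the list.
HasCount : (NumericalSemigroup → Set) → ℕ → Set
HasCount P k =
  Σ (List NumericalSemigroup) λ L →
    length L ≡ k ×
    All P L ×
    AllPairs (λ S T → ¬ (S ≈S T)) L ×
    (∀ S → P S → Any (S ≈S_) L)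

τ : ℕ → ℕ
τ n = length (filter (_∣? n) (map suc (upTo n)))

{-# OPTIONS --safe #-}
module Submission where

-- A reflective S of genus g has exactly g gaps in [0, 2g), hence no gaps beyond 2g.
-- Let m be the least positive element of S, or g + 1 if there is none up to g. Below g, S consists
-- of the multiples of m: if y + m ∈ S but y ∉ S, then g + y ∈ S, so g + y + m ∈ S, against
-- reflectivity at y + m. Reflectivity then fixes S on [g, 2g) as {g + z | m ∤ z}, and m ∤ g
-- because g ∉ S. Conversely, for each m ∈ [1, g + 1] with m ∤ g these three pieces form a
-- reflective semigroup, and different m give different semigroups (m is the least positive
-- element). There are g + 1 − τ(g) such m.

open import Defs
open import Data.Nat using (ℕ; zero; suc; _+_; _∸_; _*_; _≤_; _<_; _<?_; z<s; s≤s; s≤s⁻¹; >-nonZero)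
open import Data.Nat.Properties
open import Data.Nat.DivMod using (_/_; _%_; m≡m%n+[m/n]*n; m%n<n)
open import Data.Nat.Divisibility
  using (_∣_; _∣?_; divides; ∣⇒≤; ∣m∣n⇒∣m+n; ∣m+n∣m⇒∣n; _∣0; ∣-refl; m%n≡0⇒n∣m)
open import Algebra.Properties.CommutativeSemigroup +-commutativeSemigroup
  using (interchange; x∙yz≈y∙xz; x∙yz≈xz∙y)
open import Data.Bool using (Bool; true; false; not; if_then_else_)
open import Data.Bool.Properties using (¬-not)
import Data.Bool as Bool
open import Data.List using (List; []; _∷_; [_]; _++_; length; filter; map; upTo; applyUpTo)
open import Data.List.Properties
  using ( upTo-∷ʳ; applyUpTo-∷ʳ; map-upTo; filter-++; filter-reject; ++-identityʳ
        ; length-++; length-map; length-applyUpTo)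
open import Data.List.Membership.Propositional using (lose)
open import Data.List.Membership.Propositional.Properties using (∈-filter⁺; ∈-map⁺; ∈-applyUpTo⁺)
open import Data.List.Relation.Unary.All as All using (All; []; _∷_)
import Data.List.Relation.Unary.All.Properties as All
open import Data.List.Relation.Unary.Any using (Any)
open import Data.List.Relation.Unary.AllPairs using (AllPairs; []; _∷_)
import Data.List.Relation.Unary.AllPairs.Properties as AllPairs
open import Data.Product using (∃-syntax; _×_; _,_; proj₁; proj₂)
open import Data.Sum using (_⊎_; inj₁; inj₂)
open import Data.Empty using (⊥-elim)
open import Function using (_∘_)
open import Relation.Nullary using (¬_; Dec; yes; no; does)
open import Relation.Nullary.Decidable using (¬?; dec-true; dec-false)
open import Relation.Nullary.Negation using (contradiction)
open import Relation.Binary.PropositionalEquality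
  using (_≡_; _≢_; refl; sym; trans; cong; cong₂; subst; module ≡-Reasoning)

does-true⇒ : ∀ {A : Set} (a? : Dec A) → does a? ≡ true → A
does-true⇒ (yes a) _ = a

true≢false : true ≢ false
true≢false ()

ExactlyOneTrue : Bool → Bool → Set
ExactlyOneTrue x y = (x ≡ true × ¬ y ≡ true) ⊎ (¬ x ≡ true × y ≡ true)

exactlyOneTrue-not : ∀ x → ExactlyOneTrue x (not x)
exactlyOneTrue-not true  = inj₁ (refl , λ ())
exactlyOneTrue-not false = inj₂ ((λ ()) , refl)

exactlyOneTrue⇒not : ∀ {x y} → ExactlyOneTrue x y → y ≡ not x
exactlyOneTrue⇒not {true}  (inj₁ (_ , y≢true)) = ¬-not y≢true
exactlyOneTrue⇒not {false} (inj₂ (_ , y≡true)) = y≡true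
exactlyOneTrue⇒not {true}  (inj₂ (x≢true , _)) = contradiction refl x≢true
exactlyOneTrue⇒not {false} (inj₁ (() , _))

firstTrue : ∀ (f : ℕ → Bool) n →
            (∀ x → x < n → f x ≡ false) ⊎
            ∃[ m ] m < n × f m ≡ true × (∀ x → x < m → f x ≡ false)
firstTrue f zero = inj₁ λ _ ()
firstTrue f (suc n) with firstTrue f n
... | inj₂ (m , m<n , fm , before) = inj₂ (m , m<n⇒m<1+n m<n , fm , before)
... | inj₁ before with f n in fn
...   | true  = inj₂ (n , ≤-refl , fn , before)
...   | false = inj₁ upToN
  where
  upToN : ∀ x → x < suc n → f x ≡ false
  upToN x x<1+n with m≤n⇒m<n∨m≡n (s≤s⁻¹ x<1+n)
  ... | inj₁ x<n  = before x x<n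
  ... | inj₂ refl = fn

allPairs-discharge : ∀ {A : Set} {P : A → Set} {R : A → A → Set} {xs} →
                     All P xs → AllPairs (λ a b → P a → P b → R a b) xs → AllPairs R xs
allPairs-discharge []         []           = []
allPairs-discharge (pa ∷ pas) (ras ∷ rass) =
  All.zipWith (λ (r , pb) → r pa pb) (ras , pas) ∷ allPairs-discharge pas rass

length-filter-¬ : ∀ {A : Set} {P : A → Set} (P? : ∀ x → Dec (P x)) xs →
                  length (filter (λ x → ¬? (P? x)) xs) + length (filter P? xs) ≡ length xs
length-filter-¬ P? []       = refl
length-filter-¬ P? (x ∷ xs) with P? x
... | yes _ = trans (+-suc _ _) (cong suc (length-filter-¬ P? xs))
... | no _  = cong suc (length-filter-¬ P? xs)

gapsBelow : (ℕ → Bool) → ℕ → ℕ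
gapsBelow f zero    = 0
gapsBelow f (suc n) = gapsBelow f n + (if f n then 0 else 1)

genus≡gapsBelow-bound : ∀ S → genus S ≡ gapsBelow (mem S) (bound S)
genus≡gapsBelow-bound S = count (mem S) (bound S)
  where
  gap? : (f : ℕ → Bool) (n : ℕ) → Dec (f n ≡ false)
  gap? f n = f n Bool.≟ false

  lastGap : ∀ f n → length (filter (gap? f) [ n ]) ≡ (if f n then 0 else 1)
  lastGap f n with f n
  ... | true  = refl
  ... | false = refl

  count : ∀ f n → length (filter (gap? f) (upTo n)) ≡ gapsBelow f n
  count f zero    = refl
  count f (suc n) = begin
    length (filter (gap? f) (upTo (suc n)))
      ≡⟨ cong (length ∘ filter (gap? f)) (sym (upTo-∷ʳ n)) ⟩
    length (filter (gap? f) (upTo n ++ [ n ]))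
      ≡⟨ cong length (filter-++ (gap? f) (upTo n) [ n ]) ⟩
    length (filter (gap? f) (upTo n) ++ filter (gap? f) [ n ])
      ≡⟨ length-++ (filter (gap? f) (upTo n)) ⟩
    length (filter (gap? f) (upTo n)) + length (filter (gap? f) [ n ])
      ≡⟨ cong₂ _+_ (count f n) (lastGap f n) ⟩
    gapsBelow f (suc n) ∎
    where open ≡-Reasoning

gapsBelow-+ : ∀ f a k → gapsBelow f (a + k) ≡ gapsBelow f a + gapsBelow (λ i → f (a + i)) k
gapsBelow-+ f a zero    = trans (cong (gapsBelow f) (+-identityʳ a)) (sym (+-identityʳ _))
gapsBelow-+ f a (suc k) rewrite +-suc a k | gapsBelow-+ f a k =
  +-assoc (gapsBelow f a) (gapsBelow (λ i → f (a + i)) k) _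

gapsBelow-allTrue : ∀ f k → (∀ i → i < k → f i ≡ true) → gapsBelow f k ≡ 0
gapsBelow-allTrue f zero    _    = refl
gapsBelow-allTrue f (suc k) f≡true
  rewrite gapsBelow-allTrue f k (λ i i<k → f≡true i (m<n⇒m<1+n i<k)) | f≡true k ≤-refl = refl

gapsBelow≡0⇒true : ∀ f k → gapsBelow f k ≡ 0 → ∀ i → i < k → f i ≡ true
gapsBelow≡0⇒true f (suc k) eq i i<1+k with f k in fk
... | false = contradiction (trans (+-comm 1 _) eq) λ ()
... | true with m≤n⇒m<n∨m≡n (s≤s⁻¹ i<1+k)
...   | inj₁ i<k  = gapsBelow≡0⇒true f k (trans (sym (+-identityʳ _)) eq) i i<k
...   | inj₂ refl = fk

gapsBelow-complementary : ∀ f g → (∀ z → z < g → f (g + z) ≡ not (f z)) →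
                          gapsBelow f (g + g) ≡ g
gapsBelow-complementary f g flip = trans (gapsBelow-+ f g g) (pairs g ≤-refl)
  where
  oneGap : ∀ b → (if b then 0 else 1) + (if not b then 0 else 1) ≡ 1
  oneGap true  = refl
  oneGap false = refl

  pairs : ∀ k → k ≤ g → gapsBelow f k + gapsBelow (λ i → f (g + i)) k ≡ k
  pairs zero    _   = refl
  pairs (suc k) k<g rewrite flip k k<g = begin
    (lower + (if f k then 0 else 1)) + (upper + (if not (f k) then 0 else 1))
      ≡⟨ interchange lower _ upper _ ⟩
    (lower + upper) + ((if f k then 0 else 1) + (if not (f k) then 0 else 1))
      ≡⟨ cong₂ _+_ (pairs k (<⇒≤ k<g)) (oneGap (f k)) ⟩
    k + 1
      ≡⟨ +-comm k 1 ⟩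
    suc k ∎
    where
    open ≡-Reasoning
    lower = gapsBelow f k
    upper = gapsBelow (λ i → f (g + i)) k

-- Counting the gaps below n + bound S in two ways shows that none lies in [n, n + bound S).
allGapsBelow⇒∈ : ∀ S n → gapsBelow (mem S) n ≡ genus S → ∀ k → n ≤ k → k ∈S S
allGapsBelow⇒∈ S n gaps≡genus k n≤k with k ∸ n <? bound S
... | yes k∸n<B = subst (_∈S S) (m+[n∸m]≡n n≤k) (gapsBelow≡0⇒true _ B noGapsAbove (k ∸ n) k∸n<B)
  where
  B = bound S
  f = mem S
  noGapsAbove : gapsBelow (λ i → f (n + i)) B ≡ 0
  noGapsAbove = +-cancelˡ-≡ (genus S) _ _ (begin
    genus S + gapsBelow (λ i → f (n + i)) B
      ≡⟨ cong (_+ gapsBelow (λ i → f (n + i)) B) gaps≡genus ⟨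
    gapsBelow f n + gapsBelow (λ i → f (n + i)) B
      ≡⟨ gapsBelow-+ f n B ⟨
    gapsBelow f (n + B)
      ≡⟨ cong (gapsBelow f) (+-comm n B) ⟩
    gapsBelow f (B + n)
      ≡⟨ gapsBelow-+ f B n ⟩
    gapsBelow f B + gapsBelow (λ i → f (B + i)) n
      ≡⟨ cong₂ _+_ (sym (genus≡gapsBelow-bound S))
                   (gapsBelow-allTrue _ n (λ i _ → cofinite S (B + i) (m≤m+n B i))) ⟩
    genus S + 0 ∎)
    where open ≡-Reasoning
... | no k∸n≮B = cofinite S k (≤-trans (≮⇒≥ k∸n≮B) (m∸n≤m k n))

data Zone (g n : ℕ) : Set where
  below  : n < g → Zone g n
  middle : ∀ z → z < g → n ≡ g + z → Zone g n
  above  : g + g ≤ n → Zone g n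

zone : ∀ g n → Zone g n
zone g n with n <? g | n <? g + g
... | yes n<g | _        = below n<g
... | no n≮g  | yes n<2g = middle (n ∸ g) n∸g<g (sym (m+[n∸m]≡n g≤n))
  where
  g≤n = ≮⇒≥ n≮g
  n∸g<g = subst (n ∸ g <_) (m+n∸m≡n g g) (∸-monoˡ-< n<2g g≤n)
... | no _    | no n≮2g  = above (≮⇒≥ n≮2g)

canonicalMem : ℕ → ℕ → ℕ → Bool
canonicalMem g m n with n <? g | n <? g + g
... | yes _ | _     = does (m ∣? n)
... | no _  | yes _ = not (does (m ∣? (n ∸ g)))
... | no _  | no _  = true

module _ (g m : ℕ) where

  canonicalMem-below : ∀ {n} → n < g → canonicalMem g m n ≡ does (m ∣? n)
  canonicalMem-below {n} n<g with n <? g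
  ... | yes _   = refl
  ... | no n≮g  = contradiction n<g n≮g

  canonicalMem-middle : ∀ {z} → z < g → canonicalMem g m (g + z) ≡ not (does (m ∣? z))
  canonicalMem-middle {z} z<g with g + z <? g | g + z <? g + g
  ... | yes g+z<g | _          = contradiction g+z<g (m+n≮m g z)
  ... | no _      | yes _      = cong (not ∘ does ∘ (m ∣?_)) (m+n∸m≡n g z)
  ... | no _      | no g+z≮g+g = contradiction (+-monoʳ-< g z<g) g+z≮g+g

  canonicalMem-above : ∀ {n} → g + g ≤ n → canonicalMem g m n ≡ true
  canonicalMem-above {n} 2g≤n with n <? g | n <? g + g
  ... | yes n<g | _        = contradiction (≤-trans (m≤m+n g g) 2g≤n) (<⇒≱ n<g)
  ... | no _    | yes n<2g = contradiction 2g≤n (<⇒≱ n<2g)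
  ... | no _    | no _     = refl

  ∈canonical-below⇒∣ : ∀ {n} → n < g → canonicalMem g m n ≡ true → m ∣ n
  ∈canonical-below⇒∣ {n} n<g n∈ = does-true⇒ (m ∣? n) (trans (sym (canonicalMem-below n<g)) n∈)

  ∈canonical-middle⇒∤ : ∀ {z} → z < g → canonicalMem g m (g + z) ≡ true → ¬ m ∣ z
  ∈canonical-middle⇒∤ {z} z<g g+z∈ m∣z =
    true≢false (trans (sym g+z∈)
                      (trans (canonicalMem-middle z<g) (cong not (dec-true (m ∣? z) m∣z))))

  module _ (m∤g : ¬ m ∣ g) where

    multiple∈canonical : ∀ n → m ∣ n → canonicalMem g m n ≡ true
    multiple∈canonical n m∣n with zone g n
    ... | below n<g         = trans (canonicalMem-below n<g) (dec-true (m ∣? n) m∣n)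
    ... | middle z z<g refl = trans (canonicalMem-middle z<g) (cong not (dec-false (m ∣? z) m∤z))
      where m∤z = λ m∣z → m∤g (∣m+n∣m⇒∣n (subst (m ∣_) (+-comm g z) m∣n) m∣z)
    ... | above 2g≤n        = canonicalMem-above 2g≤n

    g+nonMultiple∈canonical : ∀ z → ¬ m ∣ z → canonicalMem g m (g + z) ≡ true
    g+nonMultiple∈canonical z m∤z with z <? g
    ... | yes z<g = trans (canonicalMem-middle z<g) (cong not (dec-false (m ∣? z) m∤z))
    ... | no z≮g  = canonicalMem-above (+-monoʳ-≤ g (≮⇒≥ z≮g))

    multiple+∈canonical : ∀ a b → m ∣ a → canonicalMem g m b ≡ true →
                          canonicalMem g m (a + b) ≡ true
    multiple+∈canonical a b m∣a b∈ with zone g b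
    ... | below b<g         = multiple∈canonical (a + b) (∣m∣n⇒∣m+n m∣a (∈canonical-below⇒∣ b<g b∈))
    ... | middle z z<g refl =
      subst (λ n → canonicalMem g m n ≡ true) (x∙yz≈y∙xz g a z)
        (g+nonMultiple∈canonical (a + z) λ m∣a+z → ∈canonical-middle⇒∤ z<g b∈ (∣m+n∣m⇒∣n m∣a+z m∣a))
    ... | above 2g≤b        = canonicalMem-above (≤-trans 2g≤b (m≤n+m b a))

    canonicalMem-closed : ∀ a b → canonicalMem g m a ≡ true → canonicalMem g m b ≡ true →
                          canonicalMem g m (a + b) ≡ true
    canonicalMem-closed a b a∈ b∈ with zone g a
    ... | below a<g  = multiple+∈canonical a b (∈canonical-below⇒∣ a<g a∈) b∈
    ... | above 2g≤a = canonicalMem-above (≤-trans 2g≤a (m≤m+n a b))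
    ... | middle z _ refl with zone g b
    ...   | below b<g       = subst (λ n → canonicalMem g m n ≡ true) (+-comm b a)
                                (multiple+∈canonical b a (∈canonical-below⇒∣ b<g b∈) a∈)
    ...   | middle w _ refl = canonicalMem-above (+-mono-≤ (m≤m+n g z) (m≤m+n g w))
    ...   | above 2g≤b      = canonicalMem-above (≤-trans 2g≤b (m≤n+m b a))

canonicalSemigroup : (g m : ℕ) → ¬ m ∣ g → NumericalSemigroup
canonicalSemigroup g m m∤g = record
  { mem      = canonicalMem g m
  ; has-zero = multiple∈canonical g m m∤g 0 (m ∣0)
  ; closed   = canonicalMem-closed g m m∤g
  ; bound    = g + g
  ; cofinite = λ _ → canonicalMem-above g m
  }

canonicalSemigroup-reflective : ∀ g m (m∤g : ¬ m ∣ g) →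
                                ReflectiveOfGenus g (canonicalSemigroup g m m∤g)
canonicalSemigroup-reflective g m m∤g =
  trans (genus≡gapsBelow-bound (canonicalSemigroup g m m∤g)) (gapsBelow-complementary M g flip) ,
  λ z z<g → subst (ExactlyOneTrue (M z)) (sym (trans (cong M (+-comm z g)) (flip z z<g)))
                  (exactlyOneTrue-not (M z))
  where
  M = canonicalMem g m
  flip : ∀ z → z < g → M (g + z) ≡ not (M z)
  flip z z<g = trans (canonicalMem-middle g m z<g) (cong not (sym (canonicalMem-below g m z<g)))

ℕ₀ : NumericalSemigroup
ℕ₀ = record
  { mem      = λ _ → true
  ; has-zero = refl
  ; closed   = λ _ _ _ _ → refl
  ; bound    = 0
  ; cofinite = λ _ _ → refl
  }

-- ℕ₀ is a junk value for divisors m of g; only non-divisors are ever listed.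
semigroupFor : ℕ → ℕ → NumericalSemigroup
semigroupFor g m with m ∣? g
... | yes _   = ℕ₀
... | no m∤g  = canonicalSemigroup g m m∤g

module _ {g m : ℕ} (m∤g : ¬ m ∣ g) where

  semigroupFor≈canonical : semigroupFor g m ≈S canonicalSemigroup g m m∤g
  semigroupFor≈canonical with m ∣? g
  ... | yes m∣g = contradiction m∣g m∤g
  ... | no _    = λ _ → refl

  semigroupFor-reflective : ReflectiveOfGenus g (semigroupFor g m)
  semigroupFor-reflective with m ∣? g
  ... | yes m∣g = contradiction m∣g m∤g
  ... | no m∤g  = canonicalSemigroup-reflective g m m∤g

semigroupFor-distinct : ∀ {g a b} → 0 < a → a < b → b ≤ suc g → ¬ a ∣ g → ¬ b ∣ g →
                        ¬ semigroupFor g a ≈S semigroupFor g b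
semigroupFor-distinct {g} {a} {b} 0<a a<b b≤1+g a∤g b∤g same = true≢false (begin
  true                      ≡⟨ dec-true (a ∣? a) ∣-refl ⟨
  does (a ∣? a)             ≡⟨ canonicalMem-below g a a<g ⟨
  canonicalMem g a a        ≡⟨ semigroupFor≈canonical a∤g a ⟨
  mem (semigroupFor g a) a  ≡⟨ same a ⟩
  mem (semigroupFor g b) a  ≡⟨ semigroupFor≈canonical b∤g a ⟩
  canonicalMem g b a        ≡⟨ canonicalMem-below g b a<g ⟩
  does (b ∣? a)             ≡⟨ dec-false (b ∣? a) (λ b∣a → <⇒≱ a<b (∣⇒≤ ⦃ >-nonZero 0<a ⦄ b∣a)) ⟩
  false                     ∎)
  where
  open ≡-Reasoning
  a<g : a < g
  a<g = ≤∧≢⇒< (s≤s⁻¹ (≤-trans a<b b≤1+g)) λ { refl → a∤g ∣-refl }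

_∤?_ : ∀ m g → Dec (¬ m ∣ g)
m ∤? g = ¬? (m ∣? g)

nonDivisors : ℕ → List ℕ
nonDivisors g = filter (_∤? g) (applyUpTo suc (suc g))

reflectiveSemigroups : ℕ → List NumericalSemigroup
reflectiveSemigroups g = map (semigroupFor g) (nonDivisors g)

τ≡divisorsUpTo-suc : ∀ g → 1 ≤ g → length (filter (_∣? g) (applyUpTo suc (suc g))) ≡ τ g
τ≡divisorsUpTo-suc g g≥1 = begin
  length (filter (_∣? g) (applyUpTo suc (suc g)))
    ≡⟨ cong (length ∘ filter (_∣? g)) (applyUpTo-∷ʳ suc g) ⟨
  length (filter (_∣? g) (applyUpTo suc g ++ [ suc g ]))
    ≡⟨ cong length (filter-++ (_∣? g) (applyUpTo suc g) [ suc g ]) ⟩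
  length (filter (_∣? g) (applyUpTo suc g) ++ filter (_∣? g) [ suc g ])
    ≡⟨ cong (λ ys → length (filter (_∣? g) (applyUpTo suc g) ++ ys)) (filter-reject (_∣? g) 1+g∤g) ⟩
  length (filter (_∣? g) (applyUpTo suc g) ++ [])
    ≡⟨ cong length (++-identityʳ (filter (_∣? g) (applyUpTo suc g))) ⟩
  length (filter (_∣? g) (applyUpTo suc g))
    ≡⟨ cong (length ∘ filter (_∣? g)) (map-upTo suc g) ⟨
  τ g ∎
  where
  open ≡-Reasoning
  1+g∤g : ¬ suc g ∣ g
  1+g∤g 1+g∣g = <⇒≱ ≤-refl (∣⇒≤ ⦃ >-nonZero g≥1 ⦄ 1+g∣g)

length-nonDivisors : ∀ g → 1 ≤ g → length (nonDivisors g) ≡ g + 1 ∸ τ g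
length-nonDivisors g g≥1 = begin
  length (nonDivisors g)
    ≡⟨ m+n∸n≡m _ (τ g) ⟨
  length (nonDivisors g) + τ g ∸ τ g
    ≡⟨ cong (λ d → length (nonDivisors g) + d ∸ τ g) (τ≡divisorsUpTo-suc g g≥1) ⟨
  length (nonDivisors g) + length (filter (_∣? g) candidates) ∸ τ g
    ≡⟨ cong (_∸ τ g) (length-filter-¬ (_∣? g) candidates) ⟩
  length candidates ∸ τ g
    ≡⟨ cong (_∸ τ g) (trans (length-applyUpTo suc (suc g)) (+-comm 1 g)) ⟩
  g + 1 ∸ τ g ∎
  where
  open ≡-Reasoning
  candidates = applyUpTo suc (suc g)

reflectiveSemigroups-distinct : ∀ g → AllPairs (λ S T → ¬ S ≈S T) (reflectiveSemigroups g)
reflectiveSemigroups-distinct g =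
  AllPairs.map⁺ (allPairs-discharge (All.all-filter (_∤? g) (applyUpTo suc (suc g)))
    (AllPairs.filter⁺ (_∤? g)
      (AllPairs.applyUpTo⁺₁ suc (suc g) λ i<j j<1+g → semigroupFor-distinct z<s (s≤s i<j) j<1+g)))

reflectiveSemigroups-reflective : ∀ g → All (ReflectiveOfGenus g) (reflectiveSemigroups g)
reflectiveSemigroups-reflective g =
  All.map⁺ (All.map semigroupFor-reflective (All.all-filter (_∤? g) (applyUpTo suc (suc g))))

module Reflective (g : ℕ) (S : NumericalSemigroup) (g≥1 : 1 ≤ g)
                  (reflective : ReflectiveOfGenus g S) where

  mem-g+ : ∀ z → z < g → mem S (g + z) ≡ not (mem S z)
  mem-g+ z z<g = trans (cong (mem S) (+-comm g z)) (exactlyOneTrue⇒not (proj₂ reflective z z<g))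

  ≥2g⇒∈ : ∀ n → g + g ≤ n → n ∈S S
  ≥2g⇒∈ = allGapsBelow⇒∈ S (g + g)
            (trans (gapsBelow-complementary (mem S) g mem-g+) (sym (proj₁ reflective)))

  g∉ : ¬ g ∈S S
  g∉ g∈ = true≢false (begin
    true             ≡⟨ g∈ ⟨
    mem S g          ≡⟨ cong (mem S) (+-identityʳ g) ⟨
    mem S (g + 0)    ≡⟨ mem-g+ 0 g≥1 ⟩
    not (mem S 0)    ≡⟨ cong not (has-zero S) ⟩
    false            ∎)
    where open ≡-Reasoning

  module Multiplicity (k : ℕ) (m∈ : suc k ≤ g → suc k ∈S S)
                      (nonePositiveBelow : ∀ x → x < k → mem S (suc x) ≡ false) where

    m : ℕ
    m = suc k

    multiple∈ : ∀ q → q * m ≤ g → (q * m) ∈S S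
    multiple∈ zero    _       = has-zero S
    multiple∈ (suc q) q*m+m≤g =
      closed S m (q * m) (m∈ (≤-trans (m≤m+n m (q * m)) q*m+m≤g))
                         (multiple∈ q (≤-trans (m≤n+m (q * m) m) q*m+m≤g))

    m∤g : ¬ m ∣ g
    m∤g (divides q g≡q*m) = g∉ (subst (_∈S S) (sym g≡q*m) (multiple∈ q (≤-reflexive (sym g≡q*m))))

    ∈-descends : ∀ y → y + m < g → (y + m) ∈S S → y ∈S S
    ∈-descends y y+m<g y+m∈ with mem S y in y∈?
    ... | true  = refl
    ... | false = ⊥-elim (true≢false (begin
      true                   ≡⟨ closed S (g + y) m g+y∈ (m∈ (≤-trans (m≤n+m m y) (<⇒≤ y+m<g))) ⟨
      mem S (g + y + m)      ≡⟨ cong (mem S) (+-assoc g y m) ⟩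
      mem S (g + (y + m))    ≡⟨ mem-g+ (y + m) y+m<g ⟩
      not (mem S (y + m))    ≡⟨ cong not y+m∈ ⟩
      false                  ∎))
      where
      open ≡-Reasoning
      g+y∈ : (g + y) ∈S S
      g+y∈ = trans (mem-g+ y (≤-<-trans (m≤m+n y m) y+m<g)) (cong not y∈?)

    remainder∈ : ∀ q r → r + q * m < g → (r + q * m) ∈S S → r ∈S S
    remainder∈ zero    r _ r+0∈ = subst (_∈S S) (+-identityʳ r) r+0∈
    remainder∈ (suc q) r x<g x∈ =
      remainder∈ q r (≤-<-trans (m≤m+n (r + q * m) m) y+m<g) (∈-descends (r + q * m) y+m<g y+m∈)
      where
      reassoc : r + (m + q * m) ≡ r + q * m + m
      reassoc = x∙yz≈xz∙y r m (q * m)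
      y+m<g = subst (_< g) reassoc x<g
      y+m∈  = subst (_∈S S) reassoc x∈

    ∈-below-g⇒∣ : ∀ x → x < g → x ∈S S → m ∣ x
    ∈-below-g⇒∣ x x<g x∈ = m%n≡0⇒n∣m x m (remainder≡0 (x % m) refl)
      where
      x≡r+q*m = m≡m%n+[m/n]*n x m
      r∈ : (x % m) ∈S S
      r∈ = remainder∈ (x / m) (x % m) (subst (_< g) x≡r+q*m x<g) (subst (_∈S S) x≡r+q*m x∈)
      remainder≡0 : ∀ r → x % m ≡ r → r ≡ 0
      remainder≡0 zero    _  = refl
      remainder≡0 (suc r) x%m≡1+r = ⊥-elim (true≢false (trans (sym (subst (_∈S S) x%m≡1+r r∈))
        (nonePositiveBelow r (s≤s⁻¹ (subst (_< m) x%m≡1+r (m%n<n x m))))))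

    mem-below-g : ∀ x → x < g → mem S x ≡ does (m ∣? x)
    mem-below-g x x<g with m ∣? x
    ... | yes m∣x@(divides q x≡q*m) = trans x∈ (sym (dec-true (m ∣? x) m∣x))
      where x∈ = subst (_∈S S) (sym x≡q*m) (multiple∈ q (subst (_≤ g) x≡q*m (<⇒≤ x<g)))
    ... | no m∤x = trans (¬-not (m∤x ∘ ∈-below-g⇒∣ x x<g)) (sym (dec-false (m ∣? x) m∤x))

    ≈canonical : S ≈S canonicalSemigroup g m m∤g
    ≈canonical n with zone g n
    ... | below n<g = trans (mem-below-g n n<g) (sym (canonicalMem-below g m n<g))
    ... | middle z z<g refl = begin
      mem S (g + z)          ≡⟨ mem-g+ z z<g ⟩
      not (mem S z)          ≡⟨ cong not (mem-below-g z z<g) ⟩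
      not (does (m ∣? z))    ≡⟨ canonicalMem-middle g m z<g ⟨
      canonicalMem g m (g + z) ∎
      where open ≡-Reasoning
    ... | above 2g≤n = trans (≥2g⇒∈ n 2g≤n) (sym (canonicalMem-above g m 2g≤n))

    listed : k ≤ g → Any (S ≈S_) (reflectiveSemigroups g)
    listed k≤g = lose (∈-map⁺ (semigroupFor g) (∈-filter⁺ (_∤? g) (∈-applyUpTo⁺ suc (s≤s k≤g)) m∤g))
                      λ n → trans (≈canonical n) (sym (semigroupFor≈canonical m∤g n))

  -- k + 1 is the least positive element of S, or g + 1 if S has none up to g.
  reflective⇒listed : Any (S ≈S_) (reflectiveSemigroups g)
  reflective⇒listed with firstTrue (mem S ∘ suc) g
  ... | inj₁ nonePositive              =
    Multiplicity.listed g (λ 1+g≤g → contradiction 1+g≤g (n≮n g)) nonePositive ≤-refl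
  ... | inj₂ (k , k<g , 1+k∈ , before) = Multiplicity.listed k (λ _ → 1+k∈) before (<⇒≤ k<g)

proposition5p2 : ∀ (g : ℕ) → 1 ≤ g →
    HasCount (ReflectiveOfGenus g) (g + 1 ∸ τ g)
proposition5p2 g g≥1 =
  reflectiveSemigroups g ,
  trans (length-map (semigroupFor g) (nonDivisors g)) (length-nonDivisors g g≥1) ,
  reflectiveSemigroups-reflective g ,
  reflectiveSemigroups-distinct g ,
  λ S reflective → Reflective.reflective⇒listed g S g≥1 reflective
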